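{- Let $R$ be a finite group, identified with its right regular permutation representation on the set $R$, and let $R<G\leq\mathrm{Sym}(R)$ with $R$ a maximal subgroup of $G$. Let $L$ be a normal subgroup of $G$. Then the $L$-orbit on $R$ containing $1$ is a subgroup of $R$. If moreover this subgroup is normal in $R$, then either $L\leq R$ or every $L$-orbit is setwise stabilized by $G_1$, the stabilizer of $1$ in $G$. -}

module Defs where

open import Level using (0ℓ)
open import Data.Nat using (ℕ)
open import Data.Fin using (Fin)
open import Data.Fin.Permutation
  using (Permutation′; _⟨$⟩ʳ_; _≈_; id; flip; _∘ₚ_)
open import Data.Product using (Σ; ∃; _×_; _,_)
open import Data.Sum using (_⊎_)
open import Relation.Nullary using (¬_)
open import Relation.Unary using (Pred; Decidable; _⊆_)
open import Relation.Binary.PropositionalEquality using (_≡_)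
open import Algebra.Core using (Op₁; Op₂)
open import Algebra.Structures using (IsGroup)

-- A finite group, presented on the carrier Fin n (every finite group is
-- isomorphic to one of this form), with propositional equality.
record FinGroup (n : ℕ) : Set where
  field
    _∙_     : Op₂ (Fin n)
    ε       : Fin n
    _⁻¹     : Op₁ (Fin n)
    isGroup : IsGroup _≡_ _∙_ ε _⁻¹
  infixl 7 _∙_
  infix 8 _⁻¹

Perm : ℕ → Set
Perm n = Permutation′ n

record IsPermSubgroup {n : ℕ} (H : Pred (Perm n) 0ℓ) : Set where
  field
    resp  : ∀ {π σ} → π ≈ σ → H π → H σ
    id∈   : H id
    ∘∈    : ∀ {π σ} → H π → H σ → H (π ∘ₚ σ)
    inv∈  : ∀ {π} → H π → H (flip π)

module _ {n : ℕ} (R : FinGroup n) where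
  open FinGroup R

  Rreg : Pred (Perm n) 0ℓ
  Rreg π = ∃ λ r → ∀ x → π ⟨$⟩ʳ x ≡ x ∙ r

  IsMaximalIn : Pred (Perm n) 0ℓ → Set₁
  IsMaximalIn G = ∀ (H : Pred (Perm n) 0ℓ) → IsPermSubgroup H →
                  Rreg ⊆ H → H ⊆ G → (H ⊆ Rreg) ⊎ (G ⊆ H)

  IsSubgroupOfR : Pred (Fin n) 0ℓ → Set
  IsSubgroupOfR S = S ε × (∀ {x y} → S x → S y → S (x ∙ y)) × (∀ {x} → S x → S (x ⁻¹))

  IsNormalInR : Pred (Fin n) 0ℓ → Set
  IsNormalInR S = ∀ r {x} → S x → S (r ⁻¹ ∙ x ∙ r)

IsNormalSubgroupOf : {n : ℕ} → Pred (Perm n) 0ℓ → Pred (Perm n) 0ℓ → Set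
IsNormalSubgroupOf L G = IsPermSubgroup L × (L ⊆ G) ×
  (∀ {g l} → G g → L l → L ((flip g ∘ₚ l) ∘ₚ g))

Orbit : {n : ℕ} → Pred (Perm n) 0ℓ → Fin n → Pred (Fin n) 0ℓ
Orbit L x y = ∃ λ l → L l × l ⟨$⟩ʳ x ≡ y

OrbitsStabilisedByPointStab : {n : ℕ} → Fin n → Pred (Perm n) 0ℓ → Pred (Perm n) 0ℓ → Set
OrbitsStabilisedByPointStab one G L =
  ∀ g → G g → g ⟨$⟩ʳ one ≡ one → ∀ x y → Orbit L x y → Orbit L x (g ⟨$⟩ʳ y)

{-# OPTIONS --safe #-}
module Submission where

-- Since R ≤ G normalises L, every right translation x ↦ x r maps L-orbits to
-- L-orbits. Hence the orbit S of 1 satisfies S r = orbit of r, which makes S a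
-- subgroup, and the product LR (maps x ↦ l (x r)) is a subgroup with R ≤ LR ≤ G.
-- By maximality either LR = R, so L ≤ R, or G = LR; in the latter case an
-- element l ρ_r of G₁ has r ∈ S, and normality of S keeps each y r, hence each
-- l (y r), in the orbit of y.

open import Defs
open import Level using (0ℓ)
open import Data.Nat using (ℕ)
open import Data.Fin using (Fin)
open import Data.Fin.Permutation as Perm
  using (_⟨$⟩ʳ_; _⟨$⟩ˡ_; _∘ₚ_; flip; permutation)
open import Data.Product using (∃; ∃₂; _×_; _,_)
open import Data.Sum as Sum using (_⊎_)
open import Relation.Nullary using (¬_)
open import Relation.Unary using (Pred; Decidable; _⊆_)
open import Relation.Binary.PropositionalEquality
  using (_≡_; refl; sym; trans; cong; subst; module ≡-Reasoning)
open import Algebra.Structures using (IsGroup)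
open import Algebra.Bundles using (Group)
import Algebra.Properties.Group as GroupProperties

module OrbitProperties {n : ℕ} {L : Pred (Perm n) 0ℓ} (isL : IsPermSubgroup L) where
  open IsPermSubgroup isL

  Orbit-refl : ∀ x → Orbit L x x
  Orbit-refl x = Perm.id , id∈ , refl

  Orbit-trans : ∀ {x y z} → Orbit L x y → Orbit L y z → Orbit L x z
  Orbit-trans (l , Ll , lx≡y) (m , Lm , my≡z) =
    l ∘ₚ m , ∘∈ Ll Lm , trans (cong (m ⟨$⟩ʳ_) lx≡y) my≡z

  Orbit-sym : ∀ {x y} → Orbit L x y → Orbit L y x
  Orbit-sym (l , Ll , lx≡y) =
    flip l , inv∈ Ll , trans (cong (l ⟨$⟩ˡ_) (sym lx≡y)) (Perm.inverseˡ l)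

module RegularRepresentation {n : ℕ} (R : FinGroup n) where
  open FinGroup R
  open IsGroup isGroup using (assoc; identityˡ; identityʳ; inverseʳ)

  group : Group 0ℓ 0ℓ
  group = record { isGroup = isGroup }

  open GroupProperties group using (//-rightDividesˡ; //-rightDividesʳ; ⁻¹-involutive)

  ρ : Fin n → Perm n
  ρ r = permutation (_∙ r) (_∙ r ⁻¹) (//-rightDividesˡ r) (//-rightDividesʳ r)

  ρ∈Rreg : ∀ r → Rreg R (ρ r)
  ρ∈Rreg r = r , λ _ → refl

  module RregNormalised {L : Pred (Perm n) 0ℓ} (isL : IsPermSubgroup L)
           (ρ-normalises : ∀ r {l} → L l → L (flip (ρ r) ∘ₚ l ∘ₚ ρ r)) where
    open IsPermSubgroup isL
    open OrbitProperties isL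

    conjugate-by-ρ : ∀ r {l} → L l →
      ∃ λ l′ → L l′ × (∀ x → l′ ⟨$⟩ʳ (x ∙ r) ≡ (l ⟨$⟩ʳ x) ∙ r)
    conjugate-by-ρ r {l} Ll = flip (ρ r) ∘ₚ l ∘ₚ ρ r , ρ-normalises r Ll ,
      λ x → cong (λ y → (l ⟨$⟩ʳ y) ∙ r) (//-rightDividesʳ r x)

    Orbit-∙ʳ : ∀ r {x y} → Orbit L x y → Orbit L (x ∙ r) (y ∙ r)
    Orbit-∙ʳ r {x} (l , Ll , lx≡y) with conjugate-by-ρ r Ll
    ... | l′ , Ll′ , l′xr≡lxr = l′ , Ll′ , trans (l′xr≡lxr x) (cong (_∙ r) lx≡y)

    Orbitε⇒Orbit : ∀ {s} z → Orbit L ε s → Orbit L z (s ∙ z)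
    Orbitε⇒Orbit {s} z s∈ = subst (λ x → Orbit L x (s ∙ z)) (identityˡ z) (Orbit-∙ʳ z s∈)

    Orbitε-isSubgroup : IsSubgroupOfR R (Orbit L ε)
    Orbitε-isSubgroup =
        Orbit-refl ε
      , (λ {_} {y} x∈ y∈ → Orbit-trans y∈ (Orbitε⇒Orbit y x∈))
      , (λ {x} x∈ → Orbit-sym (subst (Orbit L (x ⁻¹)) (inverseʳ x) (Orbitε⇒Orbit (x ⁻¹) x∈)))

    LRreg : Pred (Perm n) 0ℓ
    LRreg π = ∃₂ λ l r → L l × (∀ x → π ⟨$⟩ʳ x ≡ l ⟨$⟩ʳ (x ∙ r))

    Rreg⊆LRreg : Rreg R ⊆ LRreg
    Rreg⊆LRreg (r , πx≡xr) = Perm.id , r , id∈ , πx≡xr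

    L⊆LRreg : L ⊆ LRreg
    L⊆LRreg {l} Ll = l , ε , Ll , λ x → cong (l ⟨$⟩ʳ_) (sym (identityʳ x))

    LRreg⊆ : ∀ {G} → IsPermSubgroup G → L ⊆ G → Rreg R ⊆ G → LRreg ⊆ G
    LRreg⊆ isG L⊆G Rreg⊆G (l , r , Ll , πx≡lxr) =
      IsPermSubgroup.resp isG (λ x → sym (πx≡lxr x))
        (IsPermSubgroup.∘∈ isG (Rreg⊆G {ρ r} (ρ∈Rreg r)) (L⊆G Ll))

    LRreg-isPermSubgroup : IsPermSubgroup LRreg
    LRreg-isPermSubgroup = record
      { resp = λ { π≈σ (l , r , Ll , πx≡lxr) → l , r , Ll , λ x → trans (sym (π≈σ x)) (πx≡lxr x) }
      ; id∈  = L⊆LRreg {Perm.id} id∈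
      ; ∘∈   = λ {π} {σ} → ∘∈LRreg {π} {σ}
      ; inv∈ = λ {π} → inv∈LRreg {π}
      }
      where
      open ≡-Reasoning

      ∘∈LRreg : ∀ {π σ} → LRreg π → LRreg σ → LRreg (π ∘ₚ σ)
      ∘∈LRreg {π} {σ} (l₁ , r₁ , Ll₁ , πx≡) (l₂ , r₂ , Ll₂ , σx≡)
        with conjugate-by-ρ r₂ Ll₁
      ... | l₁′ , Ll₁′ , l₁′xr₂≡ = l₁′ ∘ₚ l₂ , r₁ ∙ r₂ , ∘∈ Ll₁′ Ll₂ , λ x → begin
        σ ⟨$⟩ʳ (π ⟨$⟩ʳ x)                  ≡⟨ cong (σ ⟨$⟩ʳ_) (πx≡ x) ⟩
        σ ⟨$⟩ʳ (l₁ ⟨$⟩ʳ (x ∙ r₁))          ≡⟨ σx≡ _ ⟩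
        l₂ ⟨$⟩ʳ ((l₁ ⟨$⟩ʳ (x ∙ r₁)) ∙ r₂)  ≡⟨ cong (l₂ ⟨$⟩ʳ_) (l₁′xr₂≡ (x ∙ r₁)) ⟨
        l₂ ⟨$⟩ʳ (l₁′ ⟨$⟩ʳ (x ∙ r₁ ∙ r₂))   ≡⟨ cong (λ y → l₂ ⟨$⟩ʳ (l₁′ ⟨$⟩ʳ y)) (assoc x r₁ r₂) ⟩
        l₂ ⟨$⟩ʳ (l₁′ ⟨$⟩ʳ (x ∙ (r₁ ∙ r₂))) ∎

      inv∈LRreg : ∀ {π} → LRreg π → LRreg (flip π)
      inv∈LRreg {π} (l , r , Ll , πx≡) with conjugate-by-ρ (r ⁻¹) (inv∈ Ll)
      ... | l′ , Ll′ , l′xr⁻¹≡ = l′ , r ⁻¹ , Ll′ , λ x → begin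
        π ⟨$⟩ˡ x                         ≡⟨ //-rightDividesʳ r _ ⟨
        (π ⟨$⟩ˡ x) ∙ r ∙ r ⁻¹            ≡⟨ cong (_∙ r ⁻¹) (π⁻¹x∙r≡l⁻¹x x) ⟩
        (l ⟨$⟩ˡ x) ∙ r ⁻¹                ≡⟨ l′xr⁻¹≡ x ⟨
        l′ ⟨$⟩ʳ (x ∙ r ⁻¹)               ∎
        where
        π⁻¹x∙r≡l⁻¹x : ∀ x → (π ⟨$⟩ˡ x) ∙ r ≡ l ⟨$⟩ˡ x
        π⁻¹x∙r≡l⁻¹x x = begin
          (π ⟨$⟩ˡ x) ∙ r                   ≡⟨ Perm.inverseˡ l ⟨
          l ⟨$⟩ˡ (l ⟨$⟩ʳ ((π ⟨$⟩ˡ x) ∙ r)) ≡⟨ cong (l ⟨$⟩ˡ_) (πx≡ _) ⟨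
          l ⟨$⟩ˡ (π ⟨$⟩ʳ (π ⟨$⟩ˡ x))       ≡⟨ cong (l ⟨$⟩ˡ_) (Perm.inverseʳ π) ⟩
          l ⟨$⟩ˡ x                         ∎

    LRreg-stabiliser-preservesOrbits : IsNormalInR R (Orbit L ε) →
      ∀ {π} → LRreg π → π ⟨$⟩ʳ ε ≡ ε → ∀ y → Orbit L y (π ⟨$⟩ʳ y)
    LRreg-stabiliser-preservesOrbits normal {π} (l , r , Ll , πx≡) πε≡ε y =
      subst (Orbit L y) (sym (πx≡ y)) (Orbit-trans y↝yr (l , Ll , refl))
      where
      ε↝r : Orbit L ε r
      ε↝r = Orbit-sym (l , Ll , trans (cong (l ⟨$⟩ʳ_) (sym (identityˡ r))) (trans (sym (πx≡ ε)) πε≡ε))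

      yry⁻¹∙y≡yr : y ⁻¹ ⁻¹ ∙ r ∙ y ⁻¹ ∙ y ≡ y ∙ r
      yry⁻¹∙y≡yr = trans (//-rightDividesˡ y _) (cong (_∙ r) (⁻¹-involutive y))

      y↝yr : Orbit L y (y ∙ r)
      y↝yr = subst (Orbit L y) yry⁻¹∙y≡yr (Orbitε⇒Orbit y (normal (y ⁻¹) ε↝r))

lemma2p7 : ∀ {n : ℕ} (R : FinGroup n) (G L : Pred (Perm n) 0ℓ) →
    IsPermSubgroup G → Decidable G → Rreg R ⊆ G → (∃ λ g → G g × ¬ Rreg R g) →
    IsMaximalIn R G → IsNormalSubgroupOf L G → Decidable L →
    IsSubgroupOfR R (Orbit L (FinGroup.ε R)) ×
    (IsNormalInR R (Orbit L (FinGroup.ε R)) →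
    (L ⊆ Rreg R) ⊎ OrbitsStabilisedByPointStab (FinGroup.ε R) G L)
lemma2p7 R G L isG _ Rreg⊆G _ maximal (isL , L⊆G , G-normalises) _ =
  Orbitε-isSubgroup , λ normal →
    Sum.map (λ LRreg⊆Rreg {l} Ll → LRreg⊆Rreg {l} (L⊆LRreg {l} Ll))
            (λ G⊆LRreg g Gg gε≡ε x y x↝y →
               Orbit-trans x↝y (LRreg-stabiliser-preservesOrbits normal {g} (G⊆LRreg {g} Gg) gε≡ε y))
            (maximal LRreg LRreg-isPermSubgroup (λ {π} → Rreg⊆LRreg {π})
                                                 (λ {π} → LRreg⊆ isG L⊆G Rreg⊆G {π}))
  where
  open RegularRepresentation R
  open RregNormalised isL (λ r → G-normalises (Rreg⊆G {ρ r} (ρ∈Rreg r)))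
  open OrbitProperties isL using (Orbit-trans)
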